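{- Let $m\geq 1$ be an integer. For all integers $n,k\geq 0$, \[ W_{m+1}(n,k)=\frac{1}{(m+1)^{k}m^{n-k}}\sum_{j=0}^{n}(-1)^{n-j}\binom{n}{j}(m+1)^{j}W_{m}(j,k), \] and $W_{1}(n,k)=S(n+1,k+1)$.
   Context: For a positive integer $m$ and integers $n,k\ge 0$, the Whitney numbers of the second kind of the Dowling lattice are $W_{m}(n,k)=\frac{1}{m^{k}k!}\sum_{i=0}^{k}\binom{k}{i}(-1)^{k-i}(mi+1)^{n}$ (equivalently, $\sum_{n\ge 0}W_m(n,k)\frac{z^n}{n!}=\frac{e^{z}}{m^k k!}(e^{mz}-1)^k$). $S(n,k)$ denotes the Stirling numbers of the second kind. -}

module Defs where

open import Data.Nat as ℕ using (ℕ; zero; suc; NonZero; _!)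
open import Data.Nat.Properties using (m^n≢0; _!≢0; m*n≢0)
open import Data.Nat.Combinatorics using (_C_)
open import Data.Integer as ℤ using (ℤ; +_; -[1+_])
open import Data.Rational using (ℚ; _/_; _+_; _*_; -_; 0ℚ; 1ℚ)

ℕ→ℚ : ℕ → ℚ
ℕ→ℚ x = (+ x) / 1

sumTo : ℕ → (ℕ → ℚ) → ℚ
sumTo zero    f = f 0
sumTo (suc n) f = sumTo n f + f (suc n)

sign : ℕ → ℚ
sign zero    = 1ℚ
sign (suc e) = - sign e

powℤ : (m : ℕ) → .{{NonZero m}} → ℤ → ℚ
powℤ m (+ e)      = ℕ→ℚ (m ℕ.^ e)
powℤ m -[1+ e ]   = _/_ (+ 1) (m ℕ.^ suc e) {{m^n≢0 m (suc e)}}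

-- Whitney numbers of the second kind of the Dowling lattice:
-- W_m(n,k) = 1/(m^k k!) Σ_{i=0}^{k} C(k,i) (-1)^{k-i} (m i + 1)^n
W : (m : ℕ) → .{{NonZero m}} → ℕ → ℕ → ℚ
W m n k =
  (_/_ (+ 1) (m ℕ.^ k ℕ.* k !) {{m*n≢0 (m ℕ.^ k) (k !) {{m^n≢0 m k}} {{k !≢0}}}})
  * sumTo k (λ i → ℕ→ℚ (k C i) * sign (k ℕ.∸ i) * ℕ→ℚ ((m ℕ.* i ℕ.+ 1) ℕ.^ n))

S : ℕ → ℕ → ℕ
S zero    zero    = 1
S zero    (suc k) = 0
S (suc n) zero    = 0
S (suc n) (suc k) = suc k ℕ.* S n (suc k) ℕ.+ S n k

module Submission where

-- With  Δᵏ p = Σ_{i≤k} C(k,i) (-1)^(k-i) p(i)  (the k-th forward difference at 0)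
-- and  powers m n i = (m i + 1)^n,  the definition reads
--     W_m(n,k) = Δᵏ[powers m n] / (m^k k!).
-- First formula: Δᵏ is linear, so it commutes with the inverse binomial
-- transform over j, and pointwise that transform collapses by the binomial
-- theorem since (m+1)(m i+1) - 1 = m((m+1) i+1):
--     Σ_j (-1)^(n-j) C(n,j) (m+1)^j Δᵏ[powers m j] = m^n Δᵏ[powers (m+1) n];
-- clearing denominators gives the formula.
-- Second formula: a Leibniz-type rule for Δᵏ⁺¹[(m i+1) p(i)], from the
-- absorption identity of binomial coefficients, yields for m = 1 the Stirling
-- recurrence, so Δᵏ[(i+1)^n] = k! S(n+1,k+1).

open import Defs
open import Data.Nat as ℕ using (ℕ; zero; suc; NonZero; _∸_; _!; s≤s)
import Data.Nat.Properties as ℕP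
open import Data.Nat.Combinatorics using (_C_; nC1≡n; nCk+nC[k+1]≡[n+1]C[k+1])
import Data.Nat.Tactic.RingSolver as ℕSolver
import Data.Integer.Tactic.RingSolver as ℤSolver
open import Data.Integer as ℤ using (+_; -[1+_])
import Data.Integer.Properties as ℤP
open import Data.Rational using (ℚ; _/_; _+_; _*_; -_; _-_; 0ℚ; 1ℚ; toℚᵘ)
import Data.Rational.Properties as ℚP
import Data.Rational.Unnormalised as ℚᵘ
import Data.Rational.Unnormalised.Properties as ℚᵘP
open import Data.Fin as Fin using (toℕ)
import Data.Fin.Properties as FinP
open import Data.Product using (_×_; _,_)
open import Data.Sum using (inj₁; inj₂)
open import Relation.Nullary.Decidable using (dec⇒maybe)
open import Algebra.Bundles using (CommutativeRing)
import Tactic.RingSolver.Core.AlmostCommutativeRing as ACR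
open import Tactic.RingSolver using (solve-∀)
open import Relation.Binary.PropositionalEquality
open CommutativeRing ℚP.+-*-commutativeRing using (semiring; commutativeSemiring)
open import Algebra.Properties.Semiring.Exp semiring using (_^_)
open import Algebra.Properties.Semiring.Sum semiring using (sum; sum-init-last; sum-cong-≗)
import Algebra.Properties.Semiring.Mult semiring as Mult
open import Algebra.Properties.CommutativeSemiring.Exp commutativeSemiring using (^-distrib-*)
import Algebra.Properties.CommutativeSemiring.Binomial commutativeSemiring as Binomial

ℚ-ring : ACR.AlmostCommutativeRing _ _
ℚ-ring = ACR.fromCommutativeRing ℚP.+-*-commutativeRing (λ x → dec⇒maybe (0ℚ ℚP.≟ x))

recip : (a : ℕ) → .{{NonZero a}} → ℚ
recip a = + 1 / a

ℕ→ℚ-suc : ∀ a → ℕ→ℚ (suc a) ≡ 1ℚ + ℕ→ℚ a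
ℕ→ℚ-suc a = ℚP.toℚᵘ-injective (begin
    toℚᵘ (ℕ→ℚ (suc a))              ≈⟨ embed (suc a) ⟩
    ℚᵘ.mkℚᵘ (+ suc a) 0             ≈⟨ ℚᵘ.*≡* (trans (cong (ℤ._* + 1) (ℤP.pos-+ 1 a)) (shape (+ a))) ⟩
    ℚᵘ.1ℚᵘ ℚᵘ.+ ℚᵘ.mkℚᵘ (+ a) 0     ≈⟨ ℚᵘP.+-congʳ ℚᵘ.1ℚᵘ (ℚᵘP.≃-sym (embed a)) ⟩
    toℚᵘ 1ℚ ℚᵘ.+ toℚᵘ (ℕ→ℚ a)       ≈⟨ ℚᵘP.≃-sym (ℚP.toℚᵘ-homo-+ 1ℚ (ℕ→ℚ a)) ⟩
    toℚᵘ (1ℚ + ℕ→ℚ a)               ∎)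
  where
  open import Relation.Binary.Reasoning.Setoid ℚᵘP.≃-setoid
  embed : ∀ b → toℚᵘ (ℕ→ℚ b) ℚᵘ.≃ ℚᵘ.mkℚᵘ (+ b) 0
  embed b = ℚP.toℚᵘ-fromℚᵘ (ℚᵘ.mkℚᵘ (+ b) 0)
  shape : ∀ x → (+ 1 ℤ.+ x) ℤ.* + 1 ≡ (+ 1 ℤ.+ x ℤ.* + 1) ℤ.* + 1
  shape = ℤSolver.solve-∀

recip-inverse : ∀ a .{{_ : NonZero a}} → recip a * ℕ→ℚ a ≡ 1ℚ
recip-inverse a@(suc a-1) = ℚP.toℚᵘ-injective (begin
    toℚᵘ (recip a * ℕ→ℚ a)                          ≈⟨ ℚP.toℚᵘ-homo-* (recip a) (ℕ→ℚ a) ⟩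
    toℚᵘ (recip a) ℚᵘ.* toℚᵘ (ℕ→ℚ a)               ≈⟨ ℚᵘP.*-cong (embed (+ 1) a-1) (embed (+ a) 0) ⟩
    ℚᵘ.mkℚᵘ (+ 1) a-1 ℚᵘ.* ℚᵘ.mkℚᵘ (+ a) 0        ≈⟨ ℚᵘ.*≡* (trans (shape (+ a)) (cong (λ d → + 1 ℤ.* + d) (sym (ℕP.*-identityʳ a)))) ⟩
    toℚᵘ 1ℚ                                         ∎)
  where
  open import Relation.Binary.Reasoning.Setoid ℚᵘP.≃-setoid
  embed : ∀ i d → toℚᵘ (i / suc d) ℚᵘ.≃ ℚᵘ.mkℚᵘ i d
  embed i d = ℚP.toℚᵘ-fromℚᵘ (ℚᵘ.mkℚᵘ i d)
  shape : ∀ x → (+ 1 ℤ.* x) ℤ.* + 1 ≡ + 1 ℤ.* x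
  shape = ℤSolver.solve-∀

open ≡-Reasoning

ℕ→ℚ-+ : ∀ a b → ℕ→ℚ (a ℕ.+ b) ≡ ℕ→ℚ a + ℕ→ℚ b
ℕ→ℚ-+ zero    b = sym (ℚP.+-identityˡ (ℕ→ℚ b))
ℕ→ℚ-+ (suc a) b = begin
  ℕ→ℚ (suc (a ℕ.+ b))          ≡⟨ ℕ→ℚ-suc (a ℕ.+ b) ⟩
  1ℚ + ℕ→ℚ (a ℕ.+ b)           ≡⟨ cong (_+_ 1ℚ) (ℕ→ℚ-+ a b) ⟩
  1ℚ + (ℕ→ℚ a + ℕ→ℚ b)         ≡⟨ ℚP.+-assoc 1ℚ (ℕ→ℚ a) (ℕ→ℚ b) ⟨
  (1ℚ + ℕ→ℚ a) + ℕ→ℚ b         ≡⟨ cong (_+ ℕ→ℚ b) (ℕ→ℚ-suc a) ⟨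
  ℕ→ℚ (suc a) + ℕ→ℚ b          ∎

ℕ→ℚ-* : ∀ a b → ℕ→ℚ (a ℕ.* b) ≡ ℕ→ℚ a * ℕ→ℚ b
ℕ→ℚ-* zero    b = sym (ℚP.*-zeroˡ (ℕ→ℚ b))
ℕ→ℚ-* (suc a) b = begin
  ℕ→ℚ (b ℕ.+ a ℕ.* b)          ≡⟨ ℕ→ℚ-+ b (a ℕ.* b) ⟩
  ℕ→ℚ b + ℕ→ℚ (a ℕ.* b)        ≡⟨ cong (_+_ (ℕ→ℚ b)) (ℕ→ℚ-* a b) ⟩
  ℕ→ℚ b + ℕ→ℚ a * ℕ→ℚ b        ≡⟨ distrib (ℕ→ℚ a) (ℕ→ℚ b) ⟩
  (1ℚ + ℕ→ℚ a) * ℕ→ℚ b         ≡⟨ cong (_* ℕ→ℚ b) (ℕ→ℚ-suc a) ⟨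
  ℕ→ℚ (suc a) * ℕ→ℚ b          ∎
  where
  distrib : ∀ x y → y + x * y ≡ (1ℚ + x) * y
  distrib = solve-∀ ℚ-ring

ℕ→ℚ-^ : ∀ a n → ℕ→ℚ (a ℕ.^ n) ≡ ℕ→ℚ a ^ n
ℕ→ℚ-^ a zero    = refl
ℕ→ℚ-^ a (suc n) = trans (ℕ→ℚ-* a (a ℕ.^ n)) (cong (ℕ→ℚ a *_) (ℕ→ℚ-^ a n))

×≡ℕ→ℚ* : ∀ n x → n Mult.× x ≡ ℕ→ℚ n * x
×≡ℕ→ℚ* zero    x = sym (ℚP.*-zeroˡ x)
×≡ℕ→ℚ* (suc n) x = begin
  x + n Mult.× x               ≡⟨ cong (_+_ x) (×≡ℕ→ℚ* n x) ⟩
  x + ℕ→ℚ n * x                ≡⟨ distrib (ℕ→ℚ n) x ⟩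
  (1ℚ + ℕ→ℚ n) * x             ≡⟨ cong (_* x) (ℕ→ℚ-suc n) ⟨
  ℕ→ℚ (suc n) * x              ∎
  where
  distrib : ∀ y x → x + y * x ≡ (1ℚ + y) * x
  distrib = solve-∀ ℚ-ring

recip-unique : ∀ a .{{_ : NonZero a}} x → x * ℕ→ℚ a ≡ 1ℚ → x ≡ recip a
recip-unique a x xa≡1 = begin
  x                            ≡⟨ ℚP.*-identityʳ x ⟨
  x * 1ℚ                       ≡⟨ cong (x *_) (recip-inverse a) ⟨
  x * (recip a * ℕ→ℚ a)        ≡⟨ regroup x (recip a) (ℕ→ℚ a) ⟩
  (x * ℕ→ℚ a) * recip a        ≡⟨ cong (_* recip a) xa≡1 ⟩
  1ℚ * recip a                 ≡⟨ ℚP.*-identityˡ (recip a) ⟩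
  recip a                      ∎
  where
  regroup : ∀ x y z → x * (y * z) ≡ (x * z) * y
  regroup = solve-∀ ℚ-ring

recip-* : ∀ a b .{{_ : NonZero a}} .{{_ : NonZero b}} →
          recip (a ℕ.* b) {{ℕP.m*n≢0 a b}} ≡ recip a * recip b
recip-* a b = sym (recip-unique (a ℕ.* b) {{ℕP.m*n≢0 a b}} (recip a * recip b) (begin
  recip a * recip b * ℕ→ℚ (a ℕ.* b)              ≡⟨ cong (recip a * recip b *_) (ℕ→ℚ-* a b) ⟩
  recip a * recip b * (ℕ→ℚ a * ℕ→ℚ b)            ≡⟨ regroup (recip a) (recip b) (ℕ→ℚ a) (ℕ→ℚ b) ⟩
  (recip a * ℕ→ℚ a) * (recip b * ℕ→ℚ b)          ≡⟨ cong₂ _*_ (recip-inverse a) (recip-inverse b) ⟩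
  1ℚ * 1ℚ                                         ≡⟨⟩
  1ℚ                                              ∎))
  where
  regroup : ∀ x y z w → x * y * (z * w) ≡ (x * z) * (y * w)
  regroup = solve-∀ ℚ-ring

recip-cancelˡ : ∀ a .{{_ : NonZero a}} x → recip a * (ℕ→ℚ a * x) ≡ x
recip-cancelˡ a x = begin
  recip a * (ℕ→ℚ a * x)        ≡⟨ ℚP.*-assoc (recip a) (ℕ→ℚ a) x ⟨
  recip a * ℕ→ℚ a * x          ≡⟨ cong (_* x) (recip-inverse a) ⟩
  1ℚ * x                       ≡⟨ ℚP.*-identityˡ x ⟩
  x                            ∎

recip-cong : ∀ {a b} .{{_ : NonZero a}} .{{_ : NonZero b}} → a ≡ b → recip a ≡ recip b
recip-cong {a} {b} a≡b =
  recip-unique b (recip a) (trans (cong (λ c → recip a * ℕ→ℚ c) (sym a≡b)) (recip-inverse a))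

ℕ→ℚ-^-* : ∀ a b n → ℕ→ℚ (a ℕ.^ n) * ℕ→ℚ (b ℕ.^ n) ≡ ℕ→ℚ (a ℕ.* b) ^ n
ℕ→ℚ-^-* a b n = begin
  ℕ→ℚ (a ℕ.^ n) * ℕ→ℚ (b ℕ.^ n)   ≡⟨ cong₂ _*_ (ℕ→ℚ-^ a n) (ℕ→ℚ-^ b n) ⟩
  ℕ→ℚ a ^ n * ℕ→ℚ b ^ n           ≡⟨ ^-distrib-* (ℕ→ℚ a) (ℕ→ℚ b) n ⟨
  (ℕ→ℚ a * ℕ→ℚ b) ^ n             ≡⟨ cong (_^ n) (ℕ→ℚ-* a b) ⟨
  ℕ→ℚ (a ℕ.* b) ^ n               ∎

sumTo-cong-≤ : ∀ n {f g : ℕ → ℚ} → (∀ i → i ℕ.≤ n → f i ≡ g i) → sumTo n f ≡ sumTo n g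
sumTo-cong-≤ zero    f≗g = f≗g 0 ℕ.z≤n
sumTo-cong-≤ (suc n) f≗g =
  cong₂ _+_ (sumTo-cong-≤ n (λ i i≤n → f≗g i (ℕP.m≤n⇒m≤1+n i≤n))) (f≗g (suc n) ℕP.≤-refl)

sumTo-cong : ∀ n {f g : ℕ → ℚ} → (∀ i → f i ≡ g i) → sumTo n f ≡ sumTo n g
sumTo-cong n f≗g = sumTo-cong-≤ n (λ i _ → f≗g i)

sumTo-+ : ∀ n (f g : ℕ → ℚ) → sumTo n (λ i → f i + g i) ≡ sumTo n f + sumTo n g
sumTo-+ zero    f g = refl
sumTo-+ (suc n) f g = begin
  sumTo n (λ i → f i + g i) + (f (suc n) + g (suc n))   ≡⟨ cong (_+ (f (suc n) + g (suc n))) (sumTo-+ n f g) ⟩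
  (sumTo n f + sumTo n g) + (f (suc n) + g (suc n))     ≡⟨ interchange (sumTo n f) (sumTo n g) (f (suc n)) (g (suc n)) ⟩
  (sumTo n f + f (suc n)) + (sumTo n g + g (suc n))     ∎
  where
  interchange : ∀ a b c d → (a + b) + (c + d) ≡ (a + c) + (b + d)
  interchange = solve-∀ ℚ-ring

sumTo-*ˡ : ∀ n c (f : ℕ → ℚ) → sumTo n (λ i → c * f i) ≡ c * sumTo n f
sumTo-*ˡ zero    c f = refl
sumTo-*ˡ (suc n) c f = trans (cong (_+ c * f (suc n)) (sumTo-*ˡ n c f))
                             (sym (ℚP.*-distribˡ-+ c (sumTo n f) (f (suc n))))

sumTo-swap : ∀ n k (f : ℕ → ℕ → ℚ) →
             sumTo n (λ j → sumTo k (f j)) ≡ sumTo k (λ i → sumTo n (λ j → f j i))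
sumTo-swap zero    k f = refl
sumTo-swap (suc n) k f = trans (cong (_+ sumTo k (f (suc n))) (sumTo-swap n k f))
                               (sym (sumTo-+ k _ (f (suc n))))

sumTo≡sum : ∀ n (f : ℕ → ℚ) → sumTo n f ≡ sum {suc n} (λ i → f (toℕ i))
sumTo≡sum zero    f = sym (ℚP.+-identityʳ (f 0))
sumTo≡sum (suc n) f = begin
  sumTo n f + f (suc n)                                  ≡⟨ cong (_+ f (suc n)) (sumTo≡sum n f) ⟩
  sum {suc n} (λ i → f (toℕ i)) + f (suc n)              ≡⟨ cong₂ _+_ (sum-cong-≗ {suc n} (λ i → cong f (sym (FinP.toℕ-inject₁ i))))
                                                                      (cong f (sym (FinP.toℕ-fromℕ (suc n)))) ⟩
  sum {suc n} (λ i → f (toℕ (Fin.inject₁ i))) + f (toℕ (Fin.fromℕ (suc n)))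
    ≡⟨ sum-init-last {suc n} (λ i → f (toℕ i)) ⟨
  sum {suc (suc n)} (λ i → f (toℕ i))                    ∎

sign≡-1^ : ∀ e → sign e ≡ (- 1ℚ) ^ e
sign≡-1^ zero    = refl
sign≡-1^ (suc e) = trans (cong -_ (sign≡-1^ e)) (neg≡-1* ((- 1ℚ) ^ e))
  where
  neg≡-1* : ∀ x → - x ≡ - 1ℚ * x
  neg≡-1* = solve-∀ ℚ-ring

binomial-alternating : ∀ n x → sumTo n (λ j → ℕ→ℚ (n C j) * x ^ j * sign (n ∸ j)) ≡ (x - 1ℚ) ^ n
binomial-alternating n x = begin
  sumTo n (λ j → ℕ→ℚ (n C j) * x ^ j * sign (n ∸ j))
    ≡⟨ sumTo-cong n term ⟩
  sumTo n (λ j → (n C j) Mult.× (x ^ j * (- 1ℚ) ^ (n ∸ j)))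
    ≡⟨ sumTo≡sum n _ ⟩
  Binomial.binomialExpansion x (- 1ℚ) n
    ≡⟨ Binomial.theorem n x (- 1ℚ) ⟨
  (x - 1ℚ) ^ n
    ∎
  where
  term : ∀ j → ℕ→ℚ (n C j) * x ^ j * sign (n ∸ j) ≡ (n C j) Mult.× (x ^ j * (- 1ℚ) ^ (n ∸ j))
  term j = begin
    ℕ→ℚ (n C j) * x ^ j * sign (n ∸ j)           ≡⟨ cong (ℕ→ℚ (n C j) * x ^ j *_) (sign≡-1^ (n ∸ j)) ⟩
    ℕ→ℚ (n C j) * x ^ j * (- 1ℚ) ^ (n ∸ j)       ≡⟨ ℚP.*-assoc (ℕ→ℚ (n C j)) (x ^ j) ((- 1ℚ) ^ (n ∸ j)) ⟩
    ℕ→ℚ (n C j) * (x ^ j * (- 1ℚ) ^ (n ∸ j))     ≡⟨ ×≡ℕ→ℚ* (n C j) _ ⟨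
    (n C j) Mult.× (x ^ j * (- 1ℚ) ^ (n ∸ j))     ∎

C-pascal : ∀ n k → suc n C suc k ≡ n C k ℕ.+ n C suc k
C-pascal n k = sym (nCk+nC[k+1]≡[n+1]C[k+1] n k)

C-vanish : ∀ n k → n ℕ.< k → n C k ≡ 0
C-vanish zero    (suc k) _         = refl
C-vanish (suc n) (suc k) (s≤s n<k) = trans (C-pascal n k)
  (cong₂ ℕ._+_ (C-vanish n k n<k) (C-vanish n (suc k) (ℕP.m<n⇒m<1+n n<k)))

C-absorption : ∀ n i → suc i ℕ.* (suc n C suc i) ≡ suc n ℕ.* (n C i)
C-absorption zero    zero    = refl
C-absorption zero    (suc i) = trans (cong (suc (suc i) ℕ.*_) (C-vanish 1 (suc (suc i)) (s≤s (s≤s ℕ.z≤n))))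
                                     (ℕP.*-zeroʳ (suc (suc i)))
C-absorption (suc n) zero    = trans (ℕP.*-identityˡ _) (trans (nC1≡n (suc (suc n))) (sym (ℕP.*-identityʳ _)))
C-absorption (suc n) (suc i) = begin
  suc (suc i) ℕ.* (suc (suc n) C suc (suc i))       ≡⟨ cong (suc (suc i) ℕ.*_) (C-pascal (suc n) (suc i)) ⟩
  suc (suc i) ℕ.* (X ℕ.+ Y)                         ≡⟨ expand i X Y ⟩
  X ℕ.+ (suc i ℕ.* X ℕ.+ suc (suc i) ℕ.* Y)         ≡⟨ cong₂ (λ u v → X ℕ.+ (u ℕ.+ v)) (C-absorption n i) (C-absorption n (suc i)) ⟩
  X ℕ.+ (suc n ℕ.* a ℕ.+ suc n ℕ.* b)               ≡⟨ cong (ℕ._+ (suc n ℕ.* a ℕ.+ suc n ℕ.* b)) (C-pascal n i) ⟩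
  (a ℕ.+ b) ℕ.+ (suc n ℕ.* a ℕ.+ suc n ℕ.* b)       ≡⟨ collect n a b ⟩
  suc (suc n) ℕ.* (a ℕ.+ b)                         ≡⟨ cong (suc (suc n) ℕ.*_) (C-pascal n i) ⟨
  suc (suc n) ℕ.* (suc n C suc i)                   ∎
  where
  X = suc n C suc i
  Y = suc n C suc (suc i)
  a = n C i
  b = n C suc i
  expand : ∀ i X Y → suc (suc i) ℕ.* (X ℕ.+ Y) ≡ X ℕ.+ (suc i ℕ.* X ℕ.+ suc (suc i) ℕ.* Y)
  expand = ℕSolver.solve-∀
  collect : ∀ n a b → (a ℕ.+ b) ℕ.+ (suc n ℕ.* a ℕ.+ suc n ℕ.* b) ≡ suc (suc n) ℕ.* (a ℕ.+ b)
  collect = ℕSolver.solve-∀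

C-shift : ∀ k i → i ℕ.* (suc k C i) ℕ.+ suc k ℕ.* (k C i) ≡ suc k ℕ.* (suc k C i)
C-shift k zero    = refl
C-shift k (suc i) = begin
  suc i ℕ.* (suc k C suc i) ℕ.+ suc k ℕ.* (k C suc i)   ≡⟨ cong (ℕ._+ suc k ℕ.* (k C suc i)) (C-absorption k i) ⟩
  suc k ℕ.* (k C i) ℕ.+ suc k ℕ.* (k C suc i)           ≡⟨ ℕP.*-distribˡ-+ (suc k) (k C i) (k C suc i) ⟨
  suc k ℕ.* (k C i ℕ.+ k C suc i)                       ≡⟨ cong (suc k ℕ.*_) (C-pascal k i) ⟨
  suc k ℕ.* (suc k C suc i)                             ∎

Δ : ℕ → (ℕ → ℚ) → ℚ
Δ k p = sumTo k (λ i → ℕ→ℚ (k C i) * sign (k ∸ i) * p i)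

Δ-cong : ∀ k {p q : ℕ → ℚ} → (∀ i → p i ≡ q i) → Δ k p ≡ Δ k q
Δ-cong k p≗q = sumTo-cong k (λ i → cong (ℕ→ℚ (k C i) * sign (k ∸ i) *_) (p≗q i))

Δ-scale : ∀ k c (p : ℕ → ℚ) → Δ k (λ i → c * p i) ≡ c * Δ k p
Δ-scale k c p = trans (sumTo-cong k (λ i → swap (ℕ→ℚ (k C i) * sign (k ∸ i)) c (p i)))
                      (sumTo-*ˡ k c (λ i → ℕ→ℚ (k C i) * sign (k ∸ i) * p i))
  where
  swap : ∀ w c x → w * (c * x) ≡ c * (w * x)
  swap = solve-∀ ℚ-ring

Δ-sumTo : ∀ k n (f : ℕ → ℕ → ℚ) → sumTo n (λ j → Δ k (f j)) ≡ Δ k (λ i → sumTo n (λ j → f j i))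
Δ-sumTo k n f = begin
  sumTo n (λ j → Δ k (f j))                     ≡⟨ sumTo-swap n k (λ j i → w i * f j i) ⟩
  sumTo k (λ i → sumTo n (λ j → w i * f j i))   ≡⟨ sumTo-cong k (λ i → sumTo-*ˡ n (w i) (λ j → f j i)) ⟩
  Δ k (λ i → sumTo n (λ j → f j i))             ∎
  where
  w : ℕ → ℚ
  w i = ℕ→ℚ (k C i) * sign (k ∸ i)

Δ-zero : ∀ p → Δ 0 p ≡ p 0
Δ-zero p = ℚP.*-identityˡ (p 0)

-- A difference of positive order annihilates constants; this is the
-- binomial theorem for (1 - 1)^(k+1).
Δ-const : ∀ k c → Δ (suc k) (λ _ → c) ≡ 0ℚ
Δ-const k c = begin
  Δ (suc k) (λ _ → c)                                              ≡⟨ Δ-cong (suc k) (λ _ → ℚP.*-identityʳ c) ⟨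
  Δ (suc k) (λ _ → c * 1ℚ)                                         ≡⟨ Δ-scale (suc k) c (λ _ → 1ℚ) ⟩
  c * Δ (suc k) (λ _ → 1ℚ)                                         ≡⟨ cong (c *_) (sumTo-cong (suc k) term) ⟩
  c * sumTo (suc k) (λ j → ℕ→ℚ (suc k C j) * 1ℚ ^ j * sign (suc k ∸ j))
                                                                   ≡⟨ cong (c *_) (binomial-alternating (suc k) 1ℚ) ⟩
  c * (0ℚ * (0ℚ ^ k))                                              ≡⟨ cong (c *_) (ℚP.*-zeroˡ (0ℚ ^ k)) ⟩
  c * 0ℚ                                                           ≡⟨ ℚP.*-zeroʳ c ⟩
  0ℚ                                                               ∎
  where
  one^ : ∀ j → 1ℚ ^ j ≡ 1ℚ
  one^ j = trans (sym (ℕ→ℚ-^ 1 j)) (cong ℕ→ℚ (ℕP.^-zeroˡ j))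
  reorder : ∀ w s → w * s * 1ℚ ≡ w * 1ℚ * s
  reorder = solve-∀ ℚ-ring
  term : ∀ j → ℕ→ℚ (suc k C j) * sign (suc k ∸ j) * 1ℚ ≡ ℕ→ℚ (suc k C j) * 1ℚ ^ j * sign (suc k ∸ j)
  term j = trans (reorder (ℕ→ℚ (suc k C j)) (sign (suc k ∸ j)))
                 (cong (λ u → ℕ→ℚ (suc k C j) * u * sign (suc k ∸ j)) (sym (one^ j)))

-- Extending the order-k difference by one index with shifted signs
-- changes nothing: the new top coefficient C(k,k+1) vanishes.
Δ-extend : ∀ k (p : ℕ → ℚ) → sumTo (suc k) (λ i → ℕ→ℚ (k C i) * - sign (suc k ∸ i) * p i) ≡ Δ k p
Δ-extend k p = begin
  sumTo k (λ i → ℕ→ℚ (k C i) * - sign (suc k ∸ i) * p i) + ℕ→ℚ (k C suc k) * - sign (k ∸ k) * p (suc k)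
    ≡⟨ cong₂ _+_ (sumTo-cong-≤ k lower) top ⟩
  Δ k p + 0ℚ
    ≡⟨ ℚP.+-identityʳ (Δ k p) ⟩
  Δ k p
    ∎
  where
  lower : ∀ i → i ℕ.≤ k → ℕ→ℚ (k C i) * - sign (suc k ∸ i) * p i ≡ ℕ→ℚ (k C i) * sign (k ∸ i) * p i
  lower i i≤k = begin
    ℕ→ℚ (k C i) * - sign (suc k ∸ i) * p i      ≡⟨ cong (λ e → ℕ→ℚ (k C i) * - sign e * p i) (ℕP.+-∸-assoc 1 i≤k) ⟩
    ℕ→ℚ (k C i) * - - sign (k ∸ i) * p i        ≡⟨ cong (λ s → ℕ→ℚ (k C i) * s * p i) (neg-involutive (sign (k ∸ i))) ⟩
    ℕ→ℚ (k C i) * sign (k ∸ i) * p i            ∎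
    where
    neg-involutive : ∀ x → - - x ≡ x
    neg-involutive = solve-∀ ℚ-ring
  top : ℕ→ℚ (k C suc k) * - sign (k ∸ k) * p (suc k) ≡ 0ℚ
  top = begin
    ℕ→ℚ (k C suc k) * - sign (k ∸ k) * p (suc k)      ≡⟨ cong (λ c → ℕ→ℚ c * - sign (k ∸ k) * p (suc k)) (C-vanish k (suc k) ℕP.≤-refl) ⟩
    0ℚ * - sign (k ∸ k) * p (suc k)                    ≡⟨ cong (_* p (suc k)) (ℚP.*-zeroˡ (- sign (k ∸ k))) ⟩
    0ℚ * p (suc k)                               ≡⟨ ℚP.*-zeroˡ (p (suc k)) ⟩
    0ℚ                                           ∎

Δ-linear-factor : ∀ m k (p : ℕ → ℚ) →
  Δ (suc k) (λ i → ℕ→ℚ (m ℕ.* i ℕ.+ 1) * p i)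
    ≡ ℕ→ℚ (suc (m ℕ.* suc k)) * Δ (suc k) p + ℕ→ℚ (m ℕ.* suc k) * Δ k p
Δ-linear-factor m k p = begin
  Δ K (λ i → ℕ→ℚ (m ℕ.* i ℕ.+ 1) * p i)
    ≡⟨ sumTo-cong K term ⟩
  sumTo K (λ i → α * (c i * s i * p i) + β * (d i * - s i * p i))
    ≡⟨ sumTo-+ K _ _ ⟩
  sumTo K (λ i → α * (c i * s i * p i)) + sumTo K (λ i → β * (d i * - s i * p i))
    ≡⟨ cong₂ _+_ (sumTo-*ˡ K α _) (sumTo-*ˡ K β _) ⟩
  α * Δ K p + β * sumTo K (λ i → d i * - s i * p i)
    ≡⟨ cong (λ z → α * Δ K p + β * z) (Δ-extend k p) ⟩
  α * Δ K p + β * Δ k p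
    ∎
  where
  K = suc k
  α = ℕ→ℚ (suc (m ℕ.* K))
  β = ℕ→ℚ (m ℕ.* K)
  c d s : ℕ → ℚ
  c i = ℕ→ℚ (K C i)
  d i = ℕ→ℚ (k C i)
  s i = sign (K ∸ i)
  coefficientsℕ : ∀ i → (K C i) ℕ.* (m ℕ.* i ℕ.+ 1) ℕ.+ m ℕ.* K ℕ.* (k C i) ≡ suc (m ℕ.* K) ℕ.* (K C i)
  coefficientsℕ i = begin
    (K C i) ℕ.* (m ℕ.* i ℕ.+ 1) ℕ.+ m ℕ.* K ℕ.* (k C i)     ≡⟨ factor m i K (K C i) (k C i) ⟩
    m ℕ.* (i ℕ.* (K C i) ℕ.+ K ℕ.* (k C i)) ℕ.+ (K C i)     ≡⟨ cong (λ z → m ℕ.* z ℕ.+ (K C i)) (C-shift k i) ⟩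
    m ℕ.* (K ℕ.* (K C i)) ℕ.+ (K C i)                       ≡⟨ collect m K (K C i) ⟩
    suc (m ℕ.* K) ℕ.* (K C i)                             ∎
    where
    factor : ∀ m i K c d → c ℕ.* (m ℕ.* i ℕ.+ 1) ℕ.+ m ℕ.* K ℕ.* d ≡ m ℕ.* (i ℕ.* c ℕ.+ K ℕ.* d) ℕ.+ c
    factor = ℕSolver.solve-∀
    collect : ∀ m K c → m ℕ.* (K ℕ.* c) ℕ.+ c ≡ suc (m ℕ.* K) ℕ.* c
    collect = ℕSolver.solve-∀
  coefficients : ∀ i → c i * ℕ→ℚ (m ℕ.* i ℕ.+ 1) + β * d i ≡ α * c i
  coefficients i = begin
    c i * ℕ→ℚ (m ℕ.* i ℕ.+ 1) + β * d i                   ≡⟨ cong₂ _+_ (ℕ→ℚ-* (K C i) _) (ℕ→ℚ-* (m ℕ.* K) (k C i)) ⟨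
    ℕ→ℚ ((K C i) ℕ.* (m ℕ.* i ℕ.+ 1)) + ℕ→ℚ (m ℕ.* K ℕ.* (k C i))  ≡⟨ ℕ→ℚ-+ ((K C i) ℕ.* (m ℕ.* i ℕ.+ 1)) (m ℕ.* K ℕ.* (k C i)) ⟨
    ℕ→ℚ ((K C i) ℕ.* (m ℕ.* i ℕ.+ 1) ℕ.+ m ℕ.* K ℕ.* (k C i))      ≡⟨ cong ℕ→ℚ (coefficientsℕ i) ⟩
    ℕ→ℚ (suc (m ℕ.* K) ℕ.* (K C i))                       ≡⟨ ℕ→ℚ-* (suc (m ℕ.* K)) (K C i) ⟩
    α * c i                                               ∎
  term : ∀ i → c i * s i * (ℕ→ℚ (m ℕ.* i ℕ.+ 1) * p i) ≡ α * (c i * s i * p i) + β * (d i * - s i * p i)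
  term i = begin
    c i * s i * (μ * p i)                                 ≡⟨ split (c i) μ β (d i) (s i) (p i) ⟩
    (c i * μ + β * d i) * s i * p i + β * (d i * - s i * p i)
                                                          ≡⟨ cong (λ z → z * s i * p i + β * (d i * - s i * p i)) (coefficients i) ⟩
    α * c i * s i * p i + β * (d i * - s i * p i)         ≡⟨ cong (_+ β * (d i * - s i * p i)) (regroup α (c i) (s i) (p i)) ⟩
    α * (c i * s i * p i) + β * (d i * - s i * p i)       ∎
    where
    μ = ℕ→ℚ (m ℕ.* i ℕ.+ 1)
    split : ∀ c μ β d s x → c * s * (μ * x) ≡ (c * μ + β * d) * s * x + β * (d * - s * x)
    split = solve-∀ ℚ-ring
    regroup : ∀ a c s x → a * c * s * x ≡ a * (c * s * x)
    regroup = solve-∀ ℚ-ring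

powers : ℕ → ℕ → ℕ → ℚ
powers m n i = ℕ→ℚ ((m ℕ.* i ℕ.+ 1) ℕ.^ n)

W-split : ∀ m .{{_ : NonZero m}} n k →
          W m n k ≡ recip (m ℕ.^ k) {{ℕP.m^n≢0 m k}} * recip (k !) {{k ℕP.!≢0}} * Δ k (powers m n)
W-split m n k = cong (_* Δ k (powers m n)) (recip-* (m ℕ.^ k) (k !) {{ℕP.m^n≢0 m k}} {{k ℕP.!≢0}})

-- Pointwise collapse of the inverse binomial transform: since
-- (m+1)(m i+1) - 1 = m((m+1) i+1), the binomial theorem gives
--   Σ_j (-1)^(n-j) C(n,j) (m+1)^j (m i+1)^j = m^n ((m+1) i+1)^n.
binomial-collapse : ∀ m n i →
  sumTo n (λ j → sign (n ∸ j) * ℕ→ℚ (n C j) * ℕ→ℚ (suc m ℕ.^ j) * powers m j i)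
    ≡ ℕ→ℚ (m ℕ.^ n) * powers (suc m) n i
binomial-collapse m n i = begin
  sumTo n (λ j → sign (n ∸ j) * ℕ→ℚ (n C j) * ℕ→ℚ (suc m ℕ.^ j) * powers m j i)
    ≡⟨ sumTo-cong n term ⟩
  sumTo n (λ j → ℕ→ℚ (n C j) * ℕ→ℚ (suc m ℕ.* y) ^ j * sign (n ∸ j))
    ≡⟨ binomial-alternating n (ℕ→ℚ (suc m ℕ.* y)) ⟩
  (ℕ→ℚ (suc m ℕ.* y) - 1ℚ) ^ n
    ≡⟨ cong (λ x → (x - 1ℚ) ^ n) (trans (cong ℕ→ℚ (shift m i)) (ℕ→ℚ-+ (m ℕ.* z) 1)) ⟩
  (ℕ→ℚ (m ℕ.* z) + 1ℚ - 1ℚ) ^ n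
    ≡⟨ cong (_^ n) (cancel (ℕ→ℚ (m ℕ.* z))) ⟩
  ℕ→ℚ (m ℕ.* z) ^ n
    ≡⟨ ℕ→ℚ-^-* m z n ⟨
  ℕ→ℚ (m ℕ.^ n) * powers (suc m) n i
    ∎
  where
  y = m ℕ.* i ℕ.+ 1
  z = suc m ℕ.* i ℕ.+ 1
  shift : ∀ m i → suc m ℕ.* (m ℕ.* i ℕ.+ 1) ≡ m ℕ.* (suc m ℕ.* i ℕ.+ 1) ℕ.+ 1
  shift = ℕSolver.solve-∀
  cancel : ∀ x → x + 1ℚ - 1ℚ ≡ x
  cancel = solve-∀ ℚ-ring
  reorder : ∀ s c u v → s * c * u * v ≡ c * (u * v) * s
  reorder = solve-∀ ℚ-ring
  term : ∀ j → sign (n ∸ j) * ℕ→ℚ (n C j) * ℕ→ℚ (suc m ℕ.^ j) * powers m j i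
               ≡ ℕ→ℚ (n C j) * ℕ→ℚ (suc m ℕ.* y) ^ j * sign (n ∸ j)
  term j = trans (reorder (sign (n ∸ j)) (ℕ→ℚ (n C j)) (ℕ→ℚ (suc m ℕ.^ j)) (powers m j i))
                 (cong (λ u → ℕ→ℚ (n C j) * u * sign (n ∸ j)) (ℕ→ℚ-^-* (suc m) y j))

Δ-powers-transfer : ∀ m n k →
  sumTo n (λ j → sign (n ∸ j) * ℕ→ℚ (n C j) * ℕ→ℚ (suc m ℕ.^ j) * Δ k (powers m j))
    ≡ ℕ→ℚ (m ℕ.^ n) * Δ k (powers (suc m) n)
Δ-powers-transfer m n k = begin
  sumTo n (λ j → t j * Δ k (powers m j))              ≡⟨ sumTo-cong n (λ j → Δ-scale k (t j) (powers m j)) ⟨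
  sumTo n (λ j → Δ k (λ i → t j * powers m j i))      ≡⟨ Δ-sumTo k n (λ j i → t j * powers m j i) ⟩
  Δ k (λ i → sumTo n (λ j → t j * powers m j i))      ≡⟨ Δ-cong k (binomial-collapse m n) ⟩
  Δ k (λ i → ℕ→ℚ (m ℕ.^ n) * powers (suc m) n i)      ≡⟨ Δ-scale k (ℕ→ℚ (m ℕ.^ n)) (powers (suc m) n) ⟩
  ℕ→ℚ (m ℕ.^ n) * Δ k (powers (suc m) n)              ∎
  where
  t : ℕ → ℚ
  t j = sign (n ∸ j) * ℕ→ℚ (n C j) * ℕ→ℚ (suc m ℕ.^ j)

powℤ-cancel : ∀ m .{{_ : NonZero m}} n k → powℤ m (+ k ℤ.- + n) * ℕ→ℚ (m ℕ.^ n) ≡ ℕ→ℚ (m ℕ.^ k)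
powℤ-cancel m n k with ℕP.≤-<-connex n k
... | inj₁ n≤k = begin
  powℤ m (+ k ℤ.- + n) * ℕ→ℚ (m ℕ.^ n)      ≡⟨ cong (λ e → powℤ m e * ℕ→ℚ (m ℕ.^ n)) (trans (ℤP.m-n≡m⊖n k n) (ℤP.⊖-≥ n≤k)) ⟩
  ℕ→ℚ (m ℕ.^ (k ∸ n)) * ℕ→ℚ (m ℕ.^ n)       ≡⟨ ℕ→ℚ-* (m ℕ.^ (k ∸ n)) (m ℕ.^ n) ⟨
  ℕ→ℚ (m ℕ.^ (k ∸ n) ℕ.* m ℕ.^ n)           ≡⟨ cong ℕ→ℚ (ℕP.^-distribˡ-+-* m (k ∸ n) n) ⟨
  ℕ→ℚ (m ℕ.^ (k ∸ n ℕ.+ n))                 ≡⟨ cong (λ e → ℕ→ℚ (m ℕ.^ e)) (ℕP.m∸n+n≡m n≤k) ⟩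
  ℕ→ℚ (m ℕ.^ k)                             ∎
... | inj₂ k<n = begin
  powℤ m (+ k ℤ.- + n) * ℕ→ℚ (m ℕ.^ n)      ≡⟨ cong₂ (λ e d → powℤ m e * ℕ→ℚ (m ℕ.^ d)) exponent n≡e+k ⟩
  r * ℕ→ℚ (m ℕ.^ (suc e ℕ.+ k))             ≡⟨ cong (λ x → r * ℕ→ℚ x) (ℕP.^-distribˡ-+-* m (suc e) k) ⟩
  r * ℕ→ℚ (m ℕ.^ suc e ℕ.* m ℕ.^ k)         ≡⟨ cong (r *_) (ℕ→ℚ-* (m ℕ.^ suc e) (m ℕ.^ k)) ⟩
  r * (ℕ→ℚ (m ℕ.^ suc e) * ℕ→ℚ (m ℕ.^ k))   ≡⟨ recip-cancelˡ (m ℕ.^ suc e) {{ℕP.m^n≢0 m (suc e)}} (ℕ→ℚ (m ℕ.^ k)) ⟩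
  ℕ→ℚ (m ℕ.^ k)                             ∎
  where
  e = n ∸ suc k
  r = recip (m ℕ.^ suc e) {{ℕP.m^n≢0 m (suc e)}}
  n∸k : n ∸ k ≡ suc e
  n∸k = ℕP.+-∸-assoc 1 k<n
  exponent : + k ℤ.- + n ≡ -[1+ e ]
  exponent = trans (ℤP.m-n≡m⊖n k n) (trans (ℤP.⊖-< k<n) (cong (λ d → ℤ.- (+ d)) n∸k))
  n≡e+k : n ≡ suc e ℕ.+ k
  n≡e+k = trans (sym (ℕP.m∸n+n≡m (ℕP.<⇒≤ k<n))) (cong (ℕ._+ k) n∸k)

-- After splitting the denominators, it is Δ-powers-transfer multiplied by
-- 1/(m+1)^k · 1/k!, using m^(k-n) m^n / m^k = 1.
W-raise : (m : ℕ) → .{{_ : NonZero m}} → (n k : ℕ) →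
  W (suc m) n k ≡ recip (suc m ℕ.^ k) {{ℕP.m^n≢0 (suc m) k}} * powℤ m (+ k ℤ.- + n)
                  * sumTo n (λ j → sign (n ∸ j) * ℕ→ℚ (n C j) * ℕ→ℚ (suc m ℕ.^ j) * W m j k)
W-raise m n k = begin
  W (suc m) n k                              ≡⟨ W-split (suc m) n k ⟩
  d * e * X                                  ≡⟨ ℚP.*-identityʳ (d * e * X) ⟨
  d * e * X * 1ℚ                             ≡⟨ cong (d * e * X *_) f*P*M≡1 ⟨
  d * e * X * (f * (P * M))                  ≡⟨ regroup d e X f P M ⟩
  d * P * (f * e * (M * X))                  ≡⟨ cong (λ z → d * P * (f * e * z)) (Δ-powers-transfer m n k) ⟨
  d * P * (f * e * sumTo n (λ j → t j * Δ k (powers m j)))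
                                             ≡⟨ cong (d * P *_) (sumTo-*ˡ n (f * e) (λ j → t j * Δ k (powers m j))) ⟨
  d * P * sumTo n (λ j → f * e * (t j * Δ k (powers m j)))
                                             ≡⟨ cong (d * P *_) (sumTo-cong n (λ j → trans (swap f e (t j) _) (cong (t j *_) (sym (W-split m j k))))) ⟩
  d * P * sumTo n (λ j → t j * W m j k)      ∎
  where
  d = recip (suc m ℕ.^ k) {{ℕP.m^n≢0 (suc m) k}}
  e = recip (k !) {{k ℕP.!≢0}}
  f = recip (m ℕ.^ k) {{ℕP.m^n≢0 m k}}
  P = powℤ m (+ k ℤ.- + n)
  M = ℕ→ℚ (m ℕ.^ n)
  X = Δ k (powers (suc m) n)
  t : ℕ → ℚ
  t j = sign (n ∸ j) * ℕ→ℚ (n C j) * ℕ→ℚ (suc m ℕ.^ j)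
  f*P*M≡1 : f * (P * M) ≡ 1ℚ
  f*P*M≡1 = trans (cong (f *_) (powℤ-cancel m n k)) (recip-inverse (m ℕ.^ k) {{ℕP.m^n≢0 m k}})
  regroup : ∀ d e X f P M → d * e * X * (f * (P * M)) ≡ d * P * (f * e * (M * X))
  regroup = solve-∀ ℚ-ring
  swap : ∀ f e t x → f * e * (t * x) ≡ t * (f * e * x)
  swap = solve-∀ ℚ-ring

S-one : ∀ n → S (suc n) 1 ≡ 1
S-one zero    = refl
S-one (suc n) = cong (λ s → 1 ℕ.* s ℕ.+ 0) (S-one n)

-- For m = 1 the differences are counted by Stirling numbers:
--   Δᵏ[(i+1)^n] = k! S(n+1,k+1),
-- since both sides satisfy the same recurrence (Δ-linear-factor with m = 1).
Δ-powers-one : ∀ n k → Δ k (powers 1 n) ≡ ℕ→ℚ (k ! ℕ.* S (suc n) (suc k))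
Δ-powers-one n zero = begin
  Δ 0 (powers 1 n)                  ≡⟨ Δ-zero (powers 1 n) ⟩
  ℕ→ℚ (1 ℕ.^ n)                     ≡⟨ cong ℕ→ℚ (ℕP.^-zeroˡ n) ⟩
  ℕ→ℚ 1                             ≡⟨ cong (λ s → ℕ→ℚ (1 ℕ.* s)) (S-one n) ⟨
  ℕ→ℚ (1 ℕ.* S (suc n) 1)           ∎
Δ-powers-one zero (suc k) = begin
  Δ (suc k) (λ _ → 1ℚ)              ≡⟨ Δ-const k 1ℚ ⟩
  ℕ→ℚ 0                             ≡⟨ cong ℕ→ℚ (ℕP.*-zeroʳ (suc k !)) ⟨
  ℕ→ℚ (suc k ! ℕ.* 0)               ≡⟨ cong (λ z → ℕ→ℚ (suc k ! ℕ.* (z ℕ.+ 0))) (ℕP.*-zeroʳ (suc (suc k))) ⟨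
  ℕ→ℚ (suc k ! ℕ.* S 1 (suc (suc k)))  ∎
Δ-powers-one (suc n) (suc k) = begin
  Δ K (powers 1 (suc n))
    ≡⟨ Δ-cong K (λ i → ℕ→ℚ-* (1 ℕ.* i ℕ.+ 1) ((1 ℕ.* i ℕ.+ 1) ℕ.^ n)) ⟩
  Δ K (λ i → ℕ→ℚ (1 ℕ.* i ℕ.+ 1) * powers 1 n i)
    ≡⟨ Δ-linear-factor 1 k (powers 1 n) ⟩
  ℕ→ℚ (suc (1 ℕ.* K)) * Δ K (powers 1 n) + ℕ→ℚ (1 ℕ.* K) * Δ k (powers 1 n)
    ≡⟨ cong₂ (λ u v → ℕ→ℚ (suc (1 ℕ.* K)) * u + ℕ→ℚ (1 ℕ.* K) * v) (Δ-powers-one n K) (Δ-powers-one n k) ⟩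
  ℕ→ℚ (suc (1 ℕ.* K)) * ℕ→ℚ (K ! ℕ.* a) + ℕ→ℚ (1 ℕ.* K) * ℕ→ℚ (k ! ℕ.* b)
    ≡⟨ cong₂ _+_ (ℕ→ℚ-* (suc (1 ℕ.* K)) (K ! ℕ.* a)) (ℕ→ℚ-* (1 ℕ.* K) (k ! ℕ.* b)) ⟨
  ℕ→ℚ (suc (1 ℕ.* K) ℕ.* (K ! ℕ.* a)) + ℕ→ℚ (1 ℕ.* K ℕ.* (k ! ℕ.* b))
    ≡⟨ ℕ→ℚ-+ (suc (1 ℕ.* K) ℕ.* (K ! ℕ.* a)) (1 ℕ.* K ℕ.* (k ! ℕ.* b)) ⟨
  ℕ→ℚ (suc (1 ℕ.* K) ℕ.* (K ! ℕ.* a) ℕ.+ 1 ℕ.* K ℕ.* (k ! ℕ.* b))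
    ≡⟨ cong ℕ→ℚ (stirling-step k (k !) a b) ⟩
  ℕ→ℚ (K ! ℕ.* S (suc (suc n)) (suc K))
    ∎
  where
  K = suc k
  a = S (suc n) (suc K)
  b = S (suc n) K
  stirling-step : ∀ k f a b → suc (1 ℕ.* suc k) ℕ.* ((suc k ℕ.* f) ℕ.* a) ℕ.+ 1 ℕ.* suc k ℕ.* (f ℕ.* b)
                              ≡ (suc k ℕ.* f) ℕ.* (suc (suc k) ℕ.* a ℕ.+ b)
  stirling-step = ℕSolver.solve-∀

W-one : (n k : ℕ) → W 1 n k ≡ ℕ→ℚ (S (suc n) (suc k))
W-one n k = begin
  W 1 n k                                               ≡⟨ cong₂ _*_ (recip-cong {{1^k*k!≢0}} {{k ℕP.!≢0}} 1^k*k!≡k!) (Δ-powers-one n k) ⟩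
  recip (k !) {{k ℕP.!≢0}} * (ℕ→ℚ (k ! ℕ.* S (suc n) (suc k)))
                                                        ≡⟨ cong (recip (k !) {{k ℕP.!≢0}} *_) (ℕ→ℚ-* (k !) (S (suc n) (suc k))) ⟩
  recip (k !) {{k ℕP.!≢0}} * (ℕ→ℚ (k !) * ℕ→ℚ (S (suc n) (suc k)))
                                                        ≡⟨ recip-cancelˡ (k !) {{k ℕP.!≢0}} (ℕ→ℚ (S (suc n) (suc k))) ⟩
  ℕ→ℚ (S (suc n) (suc k))                               ∎
  where
  1^k*k!≢0 : NonZero (1 ℕ.^ k ℕ.* k !)
  1^k*k!≢0 = ℕP.m*n≢0 (1 ℕ.^ k) (k !) {{ℕP.m^n≢0 1 k}} {{k ℕP.!≢0}}
  1^k*k!≡k! : 1 ℕ.^ k ℕ.* k ! ≡ k !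
  1^k*k!≡k! = trans (cong (ℕ._* k !) (ℕP.^-zeroˡ k)) (ℕP.*-identityˡ (k !))

mainTheorem1 :
    ((m : ℕ) → .{{_ : NonZero m}} → (n k : ℕ) →
      W (suc m) n k ≡
        (_/_ (+ 1) (suc m ℕ.^ k) {{ℕP.m^n≢0 (suc m) k}})
        * powℤ m ((+ k) ℤ.- (+ n))
        * sumTo n (λ j → sign (n ∸ j) * ℕ→ℚ (n C j) * ℕ→ℚ (suc m ℕ.^ j) * W m j k))
    × ((n k : ℕ) → W 1 n k ≡ ℕ→ℚ (S (suc n) (suc k)))
mainTheorem1 = W-raise , W-one
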